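{- Let $r\geq 1$ and let $\mathcal{L}_r$ be the set of overpartitions in which the last occurrence of a number may be overlined and there are no $r$ consecutive parts which are all non-overlined. Then $\mathcal{L}_r$ is a separable overpartition class.
   Context: An overpartition (in the "last occurrence" convention) is a partition in which the last occurrence of a number may be overlined; parts are listed in non-increasing order of size, with $\overline{t}$ listed after the non-overlined copies of $t$. Consecutiveness refers to positions in this list. For a positive integer $t$ and nonnegative integer $d$, $\overline{t}+d=\overline{t+d}$. A separable overpartition class is a set $\mathcal{P}$ of overpartitions for which there is a subset $\mathcal{B}\subset\mathcal{P}$ (the basis) such that for each $m\geq 1$ the number of overpartitions in $\mathcal{B}$ with $m$ parts is finite, every overpartition in $\mathcal{P}$ with $m$ parts is uniquely of the form $(b_1+\pi_1,\ldots,b_m+\pi_m)$ with $(b_1,\ldots,b_m)\in\mathcal{B}$ and $(\pi_1,\ldots,\pi_m)$ a non-increasing sequence of nonnegative integers, and all overpartitions of this form lie in $\mathcal{P}$. -}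

module Defs where

open import Data.Nat using (ℕ; _+_; _≤_; _<_; _≥_)
open import Data.Bool using (Bool; true; false)
open import Data.Product using (Σ; Σ-syntax; ∃; ∃-syntax; _×_; _,_; proj₁; proj₂)
open import Data.Sum using (_⊎_)
open import Data.List using (List; []; _∷_; _++_; length; zipWith)
open import Data.List.Relation.Unary.All using (All)
open import Data.List.Relation.Unary.Any using (Any)
open import Data.List.Relation.Unary.Linked using (Linked)
open import Data.List.Membership.Propositional using (_∈_)
open import Relation.Binary.PropositionalEquality using (_≡_)
open import Level using (0ℓ) renaming (suc to lsuc)

-- A part is (size t, overlined?) ; true means overlined  t̄.
Part : Set
Part = ℕ × Bool

-- p may be immediately followed by q in the listing of an overpartition:
-- sizes non-increasing, and if the sizes are equal, p is not overlined
-- (overlined t̄ is listed after all non-overlined copies of t, and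
--  at most the last occurrence of t is overlined).
Follows : Part → Part → Set
Follows (t , o) (t' , o') = (t' < t) ⊎ (t' ≡ t × o ≡ false)

IsOverpartition : List Part → Set
IsOverpartition λs = All (λ p → 1 ≤ proj₁ p) λs × Linked Follows λs

Consecutive : List Part → List Part → Set
Consecutive xs λs = Σ[ ys ∈ List Part ] Σ[ zs ∈ List Part ] λs ≡ ys ++ (xs ++ zs)

NoRNonOverlinedRun : ℕ → List Part → Set
NoRNonOverlinedRun r λs =
  (xs : List Part) → Consecutive xs λs → length xs ≡ r → Any (λ p → proj₂ p ≡ true) xs

L : ℕ → List Part → Set
L r λs = IsOverpartition λs × NoRNonOverlinedRun r λs

-- (b₁+π₁, …, bₘ+πₘ), using  t̄ + d = \overline{t+d}
addParts : List Part → List ℕ → List Part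
addParts = zipWith (λ p d → (proj₁ p + d , proj₂ p))

NonIncreasing : List ℕ → Set
NonIncreasing = Linked _≥_

Decomposition : (List Part → Set) → List Part → List Part → List ℕ → Set
Decomposition B λs b π =
  B b × length b ≡ length λs × length π ≡ length λs × NonIncreasing π × λs ≡ addParts b π

Separable : (List Part → Set) → Set₁
Separable P =
  Σ[ B ∈ (List Part → Set) ]
    ((b : List Part) → B b → P b)
  × ((m : ℕ) → 1 ≤ m →
       Σ[ enum ∈ List (List Part) ] ((b : List Part) → B b → length b ≡ m → b ∈ enum))
  × ((λs : List Part) → P λs → 1 ≤ length λs →
       Σ[ b ∈ List Part ] Σ[ π ∈ List ℕ ]
         (Decomposition B λs b π
          × ((b' : List Part) (π' : List ℕ) → Decomposition B λs b' π' → b' ≡ b × π' ≡ π)))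
  × ((b : List Part) (π : List ℕ) → B b → length π ≡ length b → NonIncreasing π →
       P (addParts b π))

{-# OPTIONS --safe #-}
-- Whether an overpartition lies in 𝓛_r depends only on its overline pattern.
-- Consecutive parts t, t' of an overpartition satisfy t ≥ t' + [t is overlined], so
-- for every pattern there is a least overpartition with it: last part 1, each part
-- exceeding the next by 1 exactly when it is overlined.  Subtracting it partwise from
-- any overpartition with the same pattern leaves a non-increasing sequence, and adding
-- a non-increasing sequence to it keeps the pattern.  Hence the minimal
-- overpartitions in 𝓛_r form a basis, with at most 2^m elements of length m.
module Submission where

open import Defs
open import Data.Nat using (ℕ; zero; suc; _+_; _∸_; _≤_)
open import Data.Nat.Properties
open import Data.Bool using (Bool; true; false)
open import Data.Product using (Σ-syntax; _×_; _,_; proj₁; proj₂)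
open import Data.Sum using (inj₁; inj₂)
open import Data.List using (List; []; _∷_; _++_; length; map)
open import Data.List.Properties using (length-map; ∷-injective)
open import Data.List.Relation.Unary.All as All using (All; []; _∷_)
open import Data.List.Relation.Unary.Any using (Any)
import Data.List.Relation.Unary.Any.Properties as Any
open import Data.List.Relation.Unary.Linked as Linked using (Linked; []; [-]; _∷_)
open import Data.List.Membership.Propositional using (_∈_)
open import Data.List.Membership.Propositional.Properties using (∈-++⁺ˡ; ∈-++⁺ʳ; ∈-map⁺)
open import Function using (_∘_)
open import Relation.Binary.PropositionalEquality

overlines : List Part → List Bool
overlines = map proj₂

overlines⇒length≡ : ∀ {xs ys} → overlines xs ≡ overlines ys → length xs ≡ length ys
overlines⇒length≡ {xs} {ys} eq =
  trans (sym (length-map proj₂ xs)) (trans (cong length eq) (length-map proj₂ ys))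

isOverpartition-tail : ∀ {p λs} → IsOverpartition (p ∷ λs) → IsOverpartition λs
isOverpartition-tail (positive , linked) = All.tail positive , Linked.tail linked

gap : Bool → ℕ
gap true  = 1
gap false = 0

-- Follows (t , o) (t' , o') does not mention o' once reduced, so callers pass o' by name.
follows⇒gap+≤ : ∀ {t o t' o'} → Follows (t , o) (t' , o') → gap o + t' ≤ t
follows⇒gap+≤ {o = true}  (inj₁ t'<t)        = t'<t
follows⇒gap+≤ {o = false} (inj₁ t'<t)        = <⇒≤ t'<t
follows⇒gap+≤ {o = true}  (inj₂ (_ , ()))
follows⇒gap+≤ {o = false} (inj₂ (refl , _)) = ≤-refl

gap+≤⇒follows : ∀ {t o t' o'} → gap o + t' ≤ t → Follows (t , o) (t' , o')
gap+≤⇒follows {o = true}  t'<t = inj₁ t'<t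
gap+≤⇒follows {o = false} t'≤t with m≤n⇒m<n∨m≡n t'≤t
... | inj₁ t'<t = inj₁ t'<t
... | inj₂ refl = inj₂ (refl , refl)

follows-+ : ∀ {t o t' o'} d {d'} → Follows (t , o) (t' , o') → d' ≤ d →
            Follows (t + d , o) (t' + d' , o')
follows-+ {t} {o} {t'} {o'} d {d'} f d'≤d = gap+≤⇒follows {o' = o'} (begin
  gap o + (t' + d') ≡⟨ +-assoc (gap o) t' d' ⟨
  gap o + t' + d'   ≤⟨ +-mono-≤ (follows⇒gap+≤ {o' = o'} f) d'≤d ⟩
  t + d             ∎)
  where open ≤-Reasoning

minimalSize : Bool → List Bool → ℕ
minimalSize o []        = 1
minimalSize o (o' ∷ os) = gap o + minimalSize o' os

minimal : List Bool → List Part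
minimal []       = []
minimal (o ∷ os) = (minimalSize o os , o) ∷ minimal os

minimalSize-positive : ∀ o os → 1 ≤ minimalSize o os
minimalSize-positive o []        = ≤-refl
minimalSize-positive o (o' ∷ os) = ≤-trans (minimalSize-positive o' os) (m≤n+m _ (gap o))

minimal-isOverpartition : ∀ os → IsOverpartition (minimal os)
minimal-isOverpartition os = positive os , linked os
  where
  positive : ∀ os → All (λ p → 1 ≤ proj₁ p) (minimal os)
  positive []       = []
  positive (o ∷ os) = minimalSize-positive o os ∷ positive os
  linked : ∀ os → Linked Follows (minimal os)
  linked []            = []
  linked (o ∷ [])      = [-]
  linked (o ∷ o' ∷ os) = gap+≤⇒follows {o' = o'} ≤-refl ∷ linked (o' ∷ os)

overlines-minimal : ∀ os → overlines (minimal os) ≡ os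
overlines-minimal []       = refl
overlines-minimal (o ∷ os) = cong (o ∷_) (overlines-minimal os)

length-minimal : ∀ os → length (minimal os) ≡ length os
length-minimal []       = refl
length-minimal (o ∷ os) = cong suc (length-minimal os)

minimalSize-≤ : ∀ {t o} λs → IsOverpartition ((t , o) ∷ λs) → minimalSize o (overlines λs) ≤ t
minimalSize-≤ []                     (t≥1 ∷ _ , _)     = t≥1
minimalSize-≤ {o = o} ((_ , o') ∷ λs) op@(_ , f ∷ _) =
  ≤-trans (+-monoʳ-≤ (gap o) (minimalSize-≤ λs (isOverpartition-tail op))) (follows⇒gap+≤ {o' = o'} f)

overlines-addParts : ∀ b π → length π ≡ length b → overlines (addParts b π) ≡ overlines b
overlines-addParts []      []      _   = refl
overlines-addParts (p ∷ b) (d ∷ π) |π| = cong (proj₂ p ∷_) (overlines-addParts b π (suc-injective |π|))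

addParts-isOverpartition : ∀ b π → IsOverpartition b → NonIncreasing π →
                           IsOverpartition (addParts b π)
addParts-isOverpartition b π (positive , linked) ni = positive-+ b π positive , linked-+ b π linked ni
  where
  positive-+ : ∀ b π → All (λ p → 1 ≤ proj₁ p) b → All (λ p → 1 ≤ proj₁ p) (addParts b π)
  positive-+ []      _       _          = []
  positive-+ (_ ∷ _) []      _          = []
  positive-+ (p ∷ b) (d ∷ π) (t≥1 ∷ ps) = ≤-trans t≥1 (m≤m+n _ d) ∷ positive-+ b π ps
  linked-+ : ∀ b π → Linked Follows b → NonIncreasing π → Linked Follows (addParts b π)
  linked-+ []          _            _        _          = []
  linked-+ (_ ∷ _)     []           _        _          = []
  linked-+ (_ ∷ [])    (_ ∷ _)      _        _          = [-]
  linked-+ (_ ∷ _ ∷ _) (_ ∷ [])     _        _          = [-]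
  linked-+ (_ ∷ q@(_ , o') ∷ b) (d ∷ d' ∷ π) (f ∷ fs) (d'≤d ∷ ni) =
    follows-+ {o' = o'} d f d'≤d ∷ linked-+ (q ∷ b) (d' ∷ π) fs ni

addParts-cancelˡ : ∀ b {π π'} → length π ≡ length b → length π' ≡ length b →
                   addParts b π ≡ addParts b π' → π ≡ π'
addParts-cancelˡ []      {[]}    {[]}     _   _    _  = refl
addParts-cancelˡ (p ∷ b) {d ∷ π} {d' ∷ π'} |π| |π'| eq with ∷-injective eq
... | head≡ , tail≡ =
  cong₂ _∷_ (+-cancelˡ-≡ (proj₁ p) d d' (cong proj₁ head≡))
            (addParts-cancelˡ b (suc-injective |π|) (suc-injective |π'|) tail≡)

excess : List Part → List ℕ
excess []              = []
excess ((t , o) ∷ λs) = t ∸ minimalSize o (overlines λs) ∷ excess λs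

length-excess : ∀ λs → length (excess λs) ≡ length λs
length-excess []       = refl
length-excess (_ ∷ λs) = cong suc (length-excess λs)

addParts-minimal-excess : ∀ λs → IsOverpartition λs →
                          addParts (minimal (overlines λs)) (excess λs) ≡ λs
addParts-minimal-excess []             _  = refl
addParts-minimal-excess ((t , o) ∷ λs) op =
  cong₂ _∷_ (cong (_, o) (m+[n∸m]≡n (minimalSize-≤ λs op)))
            (addParts-minimal-excess λs (isOverpartition-tail op))

excess-nonIncreasing : ∀ λs → IsOverpartition λs → NonIncreasing (excess λs)
excess-nonIncreasing []                             _  = []
excess-nonIncreasing (_ ∷ [])                       _  = [-]
excess-nonIncreasing ((t , o) ∷ (t' , o') ∷ λs) op@(_ , f ∷ _) =
  excess-step ∷ excess-nonIncreasing ((t' , o') ∷ λs) (isOverpartition-tail op)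
  where
  open ≤-Reasoning
  H = minimalSize o' (overlines λs)
  excess-step : t' ∸ H ≤ t ∸ (gap o + H)
  excess-step = begin
    t' ∸ H                     ≡⟨ [m+n]∸[m+o]≡n∸o (gap o) t' H ⟨
    (gap o + t') ∸ (gap o + H) ≤⟨ ∸-monoˡ-≤ (gap o + H) (follows⇒gap+≤ {o' = o'} f) ⟩
    t ∸ (gap o + H)            ∎

allPatterns : ℕ → List (List Bool)
allPatterns zero    = [] ∷ []
allPatterns (suc m) = map (true ∷_) (allPatterns m) ++ map (false ∷_) (allPatterns m)

∈-allPatterns : ∀ os → os ∈ allPatterns (length os)
∈-allPatterns []           = Any.here refl
∈-allPatterns (true ∷ os)  = ∈-++⁺ˡ (∈-map⁺ (true ∷_) (∈-allPatterns os))
∈-allPatterns (false ∷ os) =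
  ∈-++⁺ʳ (map (true ∷_) (allPatterns (length os))) (∈-map⁺ (false ∷_) (∈-allPatterns os))

OverlineInvariant : (List Part → Set) → Set
OverlineInvariant Q = ∀ {a c} → overlines a ≡ overlines c → Q a → Q c

module _ (Q : List Part → Set) (Q-invariant : OverlineInvariant Q) where

  MinimalBasis : List Part → Set
  MinimalBasis b = Q b × b ≡ minimal (overlines b)

  minimalBasis⊆ : ∀ b → MinimalBasis b → IsOverpartition b × Q b
  minimalBasis⊆ b (q , b≡) = subst IsOverpartition (sym b≡) (minimal-isOverpartition _) , q

  minimalBasis-finite : ∀ m → 1 ≤ m →
    Σ[ enum ∈ List (List Part) ] (∀ b → MinimalBasis b → length b ≡ m → b ∈ enum)
  minimalBasis-finite m _ = map minimal (allPatterns m) , λ where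
    b (_ , b≡) refl → subst (_∈ map minimal (allPatterns (length b))) (sym b≡)
      (subst (λ k → minimal (overlines b) ∈ map minimal (allPatterns k)) (length-map proj₂ b)
        (∈-map⁺ minimal (∈-allPatterns (overlines b))))

  decomposition : ∀ λs → IsOverpartition λs → Q λs →
                  Decomposition MinimalBasis λs (minimal (overlines λs)) (excess λs)
  decomposition λs op q =
    (Q-invariant (sym (overlines-minimal _)) q , cong minimal (sym (overlines-minimal _))) ,
    trans (length-minimal (overlines λs)) (length-map proj₂ λs) ,
    length-excess λs ,
    excess-nonIncreasing λs op ,
    sym (addParts-minimal-excess λs op)

  decomposition-unique : ∀ {λs b π} → IsOverpartition λs → Decomposition MinimalBasis λs b π →
                         b ≡ minimal (overlines λs) × π ≡ excess λs
  decomposition-unique {λs} {b} {π} op ((_ , b≡) , |b| , |π| , _ , λs≡) = b≡minimal , π≡excess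
    where
    open ≡-Reasoning
    |π|≡|b| : length π ≡ length b
    |π|≡|b| = trans |π| (sym |b|)
    b≡minimal : b ≡ minimal (overlines λs)
    b≡minimal = begin
      b                                  ≡⟨ b≡ ⟩
      minimal (overlines b)              ≡⟨ cong minimal (overlines-addParts b π |π|≡|b|) ⟨
      minimal (overlines (addParts b π)) ≡⟨ cong (minimal ∘ overlines) λs≡ ⟨
      minimal (overlines λs)             ∎
    π≡excess : π ≡ excess λs
    π≡excess = addParts-cancelˡ b |π|≡|b| (trans (length-excess λs) (sym |b|)) (begin
      addParts b π                                  ≡⟨ λs≡ ⟨
      λs                                            ≡⟨ addParts-minimal-excess λs op ⟨
      addParts (minimal (overlines λs)) (excess λs) ≡⟨ cong (λ b' → addParts b' (excess λs)) b≡minimal ⟨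
      addParts b (excess λs)                        ∎)

  addParts-closed : ∀ b π → MinimalBasis b → length π ≡ length b → NonIncreasing π →
                    IsOverpartition (addParts b π) × Q (addParts b π)
  addParts-closed b π (q , b≡) |π| ni =
    addParts-isOverpartition b π (proj₁ (minimalBasis⊆ b (q , b≡))) ni ,
    Q-invariant (sym (overlines-addParts b π |π|)) q

  overlineInvariant⇒separable : Separable (λ λs → IsOverpartition λs × Q λs)
  overlineInvariant⇒separable =
    MinimalBasis , minimalBasis⊆ , minimalBasis-finite ,
    (λ λs (op , q) _ → _ , _ , decomposition λs op q , λ _ _ → decomposition-unique op) ,
    addParts-closed

overlines-++⁻ : ∀ ys zs {a} → overlines a ≡ overlines (ys ++ zs) →
  Σ[ ys' ∈ List Part ] Σ[ zs' ∈ List Part ]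
    a ≡ ys' ++ zs' × overlines ys' ≡ overlines ys × overlines zs' ≡ overlines zs
overlines-++⁻ []       zs {a}     eq = [] , a , refl , refl , eq
overlines-++⁻ (y ∷ ys) zs {x ∷ a} eq with ∷-injective eq
... | head≡ , tail≡ with overlines-++⁻ ys zs tail≡
... | ys' , zs' , refl , ys≡ , zs≡ = x ∷ ys' , zs' , refl , cong₂ _∷_ head≡ ys≡ , zs≡

hasOverlined-transfer : ∀ {xs ys} → overlines xs ≡ overlines ys →
  Any (λ p → proj₂ p ≡ true) xs → Any (λ p → proj₂ p ≡ true) ys
hasOverlined-transfer eq = Any.map⁻ ∘ subst (Any (_≡ true)) eq ∘ Any.map⁺

noRNonOverlinedRun-invariant : ∀ r → OverlineInvariant (NoRNonOverlinedRun r)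
noRNonOverlinedRun-invariant r eq noRun xs (ys , zs , refl) |xs|
  with overlines-++⁻ ys (xs ++ zs) eq
... | ys' , ws , refl , _ , ws≡ with overlines-++⁻ xs zs ws≡
... | xs' , zs' , refl , xs≡ , _ =
  hasOverlined-transfer xs≡ (noRun xs' (ys' , zs' , refl) (trans (overlines⇒length≡ xs≡) |xs|))

theorem5p4 : (r : ℕ) → 1 ≤ r → Separable (L r)
theorem5p4 r _ = overlineInvariant⇒separable (NoRNonOverlinedRun r) (noRNonOverlinedRun-invariant r)
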